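{- If $f$ is a cover with $\deg f\le 2$, then $f$ is Galois.
   Context: Let $\mathbf C$ be a category and $\mathbf D$ a full subcategory of $\mathbf C$. For arrows $f,g$ of $\mathbf C$ with ${\rm cod}\,f={\rm cod}\,g$, ${\rm Hom}(g,f)$ denotes the collection of all arrows $h$ of $\mathbf C$ with $g=f\circ h$. Standing assumptions: (G1) every diagram $B\to A\leftarrow C$ in $\mathbf D$ has a pullback in $\mathbf C$. (G2) (I) pushouts exist in $\mathbf D$; (II) every arrow of $\mathbf D$ is epic; (III) every monic arrow of $\mathbf D$ is an isomorphism whose inverse is an arrow of $\mathbf D$. (G3) for every object $U$ of $\mathbf C$ there is a set $\Sigma(U)$ of arrows $i$ of $\mathbf C$ with ${\rm dom}\,i$ in $\mathbf D$ and ${\rm cod}\,i=U$ such that for every arrow $u$ of $\mathbf C$ with ${\rm dom}\,u$ in $\mathbf D$ and ${\rm cod}\,u=U$ there is exactly one $i\in\Sigma(U)$ with ${\rm Hom}(u,i)\neq\emptyset$. (G4) there is a function $\deg$ from the collection of arrows of $\mathbf C$ whose codomain lies in $\mathbf D$ to the positive integers such that (I) $\deg(g\circ f)=\deg g\cdot\deg f$ whenever $f,g,g\circ f$ all lie in this collection; (II) $\deg f=\sum_{i\in\Sigma({\rm dom}\,f)}\deg(f\circ i)$ for every such $f$; (III) if $B\xrightarrow{f}A\xleftarrow{g}C$ is a diagram in $\mathbf D$ with pullback $B\xleftarrow{p}U\xrightarrow{q}C$, then $\deg f=\deg q$ and $\deg g=\deg p$. A cover is an arrow of $\mathbf D$.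 For a cover $f$, ${\rm Aut}(f)$ is the set of isomorphisms in ${\rm Hom}(f,f)$; $f$ is Galois if $|{\rm Aut}(f)|=\deg f$. -}

module Defs where

open import Level using (Level; _⊔_) renaming (suc to lsuc)
open import Data.Nat using (ℕ; zero; suc; _+_; _*_; _≤_)
open import Data.Fin using (Fin; zero; suc)
open import Data.Product using (Σ; _×_; _,_; proj₁; proj₂)
open import Relation.Binary.PropositionalEquality using (_≡_)

sumFin : (n : ℕ) → (Fin n → ℕ) → ℕ
sumFin zero    a = 0
sumFin (suc n) a = a zero + sumFin n (λ k → a (suc k))

-- A type A has exactly n elements, counted up to the equivalence
-- "same image under key": there is an enumeration Fin n → A which is
-- injective and surjective modulo key.
HasCardBy : ∀ {a b} {A : Set a} {B : Set b} → (A → B) → ℕ → Set (a ⊔ b)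
HasCardBy {A = A} key n =
  Σ (Fin n → A) λ e →
    (∀ k l → key (e k) ≡ key (e l) → k ≡ l) ×
    (∀ x → Σ (Fin n) λ k → key (e k) ≡ key x)

FinBij : ∀ {a} (A : Set a) → ℕ → Set a
FinBij A n =
  Σ (Fin n → A) λ e →
    (∀ k l → e k ≡ e l → k ≡ l) × (∀ x → Σ (Fin n) λ k → e k ≡ x)

record Category (o ℓ : Level) : Set (lsuc (o ⊔ ℓ)) where
  infixr 9 _∘_
  field
    Obj : Set o
    Hom : Obj → Obj → Set ℓ
    id  : ∀ {A} → Hom A A
    _∘_ : ∀ {A B C} → Hom B C → Hom A B → Hom A C
    identityˡ : ∀ {A B} (f : Hom A B) → id ∘ f ≡ f
    identityʳ : ∀ {A B} (f : Hom A B) → f ∘ id ≡ f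
    assoc : ∀ {A B C E} (f : Hom A B) (g : Hom B C) (h : Hom C E) →
            (h ∘ g) ∘ f ≡ h ∘ (g ∘ f)

module CatDefs {o ℓ : Level} (𝐂 : Category o ℓ) where
  open Category 𝐂

  HomOver : ∀ {X Y A} → Hom X A → Hom Y A → Set ℓ
  HomOver {X} {Y} g f = Σ (Hom X Y) λ h → g ≡ f ∘ h

  IsIso : ∀ {A B} → Hom A B → Set ℓ
  IsIso {A} {B} f = Σ (Hom B A) λ g → (g ∘ f ≡ id) × (f ∘ g ≡ id)

  record IsPullback {A B C' U : Obj} (f : Hom B A) (g : Hom C' A)
                    (p : Hom U B) (q : Hom U C') : Set (o ⊔ ℓ) where
    field
      commute   : f ∘ p ≡ g ∘ q
      universal : ∀ {W} (a : Hom W B) (b : Hom W C') → f ∘ a ≡ g ∘ b →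
                  Σ (Hom W U) λ m → ((p ∘ m ≡ a) × (q ∘ m ≡ b)) ×
                    (∀ m' → p ∘ m' ≡ a → q ∘ m' ≡ b → m' ≡ m)

  record Pullback {A B C' : Obj} (f : Hom B A) (g : Hom C' A) : Set (o ⊔ ℓ) where
    field
      U : Obj
      p : Hom U B
      q : Hom U C'
      isPullback : IsPullback f g p q

  module Sub {d : Level} (D : Obj → Set d) where

    record PushoutInD {A B C' : Obj} (f : Hom A B) (g : Hom A C') : Set (o ⊔ ℓ ⊔ d) where
      field
        P   : Obj
        P∈D : D P
        i₁  : Hom B P
        i₂  : Hom C' P
        commute : i₁ ∘ f ≡ i₂ ∘ g
        universal : ∀ {Z} → D Z → (a : Hom B Z) (b : Hom C' Z) → a ∘ f ≡ b ∘ g →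
                    Σ (Hom P Z) λ m → ((m ∘ i₁ ≡ a) × (m ∘ i₂ ≡ b)) ×
                      (∀ m' → m' ∘ i₁ ≡ a → m' ∘ i₂ ≡ b → m' ≡ m)

    EpicInD : ∀ {X Y} → Hom X Y → Set (o ⊔ ℓ ⊔ d)
    EpicInD {X} {Y} f = ∀ {Z} → D Z → (g h : Hom Y Z) → g ∘ f ≡ h ∘ f → g ≡ h

    MonicInD : ∀ {X Y} → Hom X Y → Set (o ⊔ ℓ ⊔ d)
    MonicInD {X} {Y} f = ∀ {Z} → D Z → (g h : Hom Z X) → f ∘ g ≡ f ∘ h → g ≡ h

-- The standing assumptions (G1)–(G4) on a category C with a full
-- subcategory D (given by the predicate D on objects).
record GaloisSetting {o ℓ : Level} (𝐂 : Category o ℓ) (d s : Level)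
       : Set (lsuc (o ⊔ ℓ ⊔ d ⊔ s)) where
  open Category 𝐂
  open CatDefs 𝐂
  field
    D : Obj → Set d
  open Sub D
  field
    pullback : ∀ {A B C'} → D A → D B → D C' →
               (f : Hom B A) (g : Hom C' A) → Pullback f g
    pushout  : ∀ {A B C'} → D A → D B → D C' →
               (f : Hom A B) (g : Hom A C') → PushoutInD f g
    epic     : ∀ {X Y} → D X → D Y → (f : Hom X Y) → EpicInD f
    -- (G2)(III)  (the inverse is automatically in D, D being full)
    monic⇒iso : ∀ {X Y} → D X → D Y → (f : Hom X Y) → MonicInD f → IsIso f
    -- (G3)  Σ(U) is the family  Sarr : Idx U → arrows into U
    Idx      : Obj → Set s
    Sdom     : ∀ {U} → Idx U → Obj
    Sdom∈D   : ∀ {U} (i : Idx U) → D (Sdom i)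
    Sarr     : ∀ {U} (i : Idx U) → Hom (Sdom i) U
    Σ-unique : ∀ {U X} → D X → (u : Hom X U) →
               Σ (Idx U) λ i → HomOver u (Sarr i) ×
                 (∀ j → HomOver u (Sarr j) → j ≡ i)
    -- (G4) deg is defined on arrows whose codomain lies in D
    deg      : ∀ {X Y} → Hom X Y → .(D Y) → ℕ
    deg-pos  : ∀ {X Y} (f : Hom X Y) .(y : D Y) → 1 ≤ deg f y
    deg-∘    : ∀ {X Y Z} (f : Hom X Y) (g : Hom Y Z) .(y : D Y) .(z : D Z) →
               deg (g ∘ f) z ≡ deg g z * deg f y
    -- (G4)(II)  (Σ(dom f) is finite and the sum runs over it)
    deg-sum  : ∀ {X Y} (f : Hom X Y) .(y : D Y) →
               Σ ℕ λ n → Σ (FinBij (Idx X) n) λ e →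
                 deg f y ≡ sumFin n (λ k → deg (f ∘ Sarr (proj₁ e k)) y)
    deg-pb   : ∀ {A B C' U} (a : D A) (b : D B) (c : D C')
               (f : Hom B A) (g : Hom C' A) (p : Hom U B) (q : Hom U C') →
               IsPullback f g p q → (deg f a ≡ deg q c) × (deg g a ≡ deg p b)

module GaloisDefs {o ℓ d s : Level} {𝐂 : Category o ℓ} (G : GaloisSetting 𝐂 d s) where
  open Category 𝐂
  open CatDefs 𝐂
  open GaloisSetting G

  -- A cover is an arrow of D.  Aut(f): isomorphisms in Hom(f,f).
  Aut : ∀ {X Y} → Hom X Y → Set ℓ
  Aut {X} f = Σ (Hom X X) λ h → IsIso h × (f ≡ f ∘ h)

  -- f is Galois if |Aut(f)| = deg f  (elements of Aut(f) are arrows,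
  -- so they are counted as arrows)
  IsGalois : ∀ {X Y} → D X → D Y → Hom X Y → Set ℓ
  IsGalois x y f = HasCardBy {A = Aut f} proj₁ (deg f y)

  Cor46 : Set (o ⊔ ℓ ⊔ d)
  Cor46 = ∀ {X Y} (x : D X) (y : D Y) (f : Hom X Y) → deg f y ≤ 2 → IsGalois x y f

{-# OPTIONS --safe #-}
module Submission where

-- Pull f back along itself to get the kernel pair p, q : U → X.  An automorphism τ of f
-- is determined by the index j ∈ Σ(U) through which its graph ⟨id, τ⟩ factors, and j is
-- hit exactly when p ∘ Sarr j has degree 1: then p ∘ Sarr j and q ∘ Sarr j are both
-- isomorphisms and τ = (q ∘ Sarr j) ∘ (p ∘ Sarr j)⁻¹.  Since deg f = deg p is the sum of
-- the degrees of the p ∘ Sarr j and the diagonal always contributes a term 1, deg f ≤ 2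
-- forces every term to be 1, so Aut f is in bijection with Σ(U), of size deg f.
-- Degree-1 arrows g are isomorphisms by the same picture: Σ(U) is then a singleton, so
-- every pair equalized by g factors through the diagonal index, where p and q agree.

open import Defs
open import Level using (Level)
open import Data.Nat using (ℕ; zero; suc; _+_; _*_; _≤_; z≤n; s≤s; s≤s⁻¹; >-nonZero)
open import Data.Nat.Properties
  using (*-identityʳ; *-cancelˡ-≡; m*n≡1⇒m≡1; +-mono-≤; +-monoʳ-≤; +-suc; m≤m+n; ≤-trans; ≤-antisym; module ≤-Reasoning)
open import Data.Fin using (Fin; zero; suc)
open import Data.Product using (Σ; _,_; proj₁; proj₂)
open import Relation.Nullary using (Irrelevant)
open import Relation.Binary.PropositionalEquality

sumFin-≥-length : ∀ n (t : Fin n → ℕ) → (∀ k → 1 ≤ t k) → n ≤ sumFin n t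
sumFin-≥-length zero    t t≥1 = z≤n
sumFin-≥-length (suc n) t t≥1 =
  +-mono-≤ (t≥1 zero) (sumFin-≥-length n (λ k → t (suc k)) (λ k → t≥1 (suc k)))

term+length≤sumFin : ∀ n (t : Fin (suc n) → ℕ) → (∀ k → 1 ≤ t k) →
                     ∀ k → t k + n ≤ sumFin (suc n) t
term+length≤sumFin n       t t≥1 zero =
  +-monoʳ-≤ (t zero) (sumFin-≥-length n (λ k → t (suc k)) (λ k → t≥1 (suc k)))
term+length≤sumFin (suc n) t t≥1 (suc k) = begin
  t (suc k) + suc n    ≡⟨ +-suc (t (suc k)) n ⟩
  suc (t (suc k) + n)  ≤⟨ +-mono-≤ (t≥1 zero)
                            (term+length≤sumFin n (λ l → t (suc l)) (λ l → t≥1 (suc l)) k) ⟩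
  sumFin (suc (suc n)) t ∎
  where open ≤-Reasoning

sumFin-ones : ∀ n (t : Fin n → ℕ) → (∀ k → t k ≡ 1) → sumFin n t ≡ n
sumFin-ones zero    t t≡1 = refl
sumFin-ones (suc n) t t≡1 = cong₂ _+_ (t≡1 zero) (sumFin-ones n (λ k → t (suc k)) (λ k → t≡1 (suc k)))

-- The hypothesis on k₀ is only needed when there is a single term.
sumFin≤2⇒ones : ∀ n (t : Fin n → ℕ) → (∀ k → 1 ≤ t k) → sumFin n t ≤ 2 →
                ∀ k₀ → t k₀ ≡ 1 → ∀ k → t k ≡ 1
sumFin≤2⇒ones (suc zero)    t t≥1 sum≤2 zero t₀≡1 zero = t₀≡1
sumFin≤2⇒ones (suc (suc n)) t t≥1 sum≤2 k₀ t₀≡1 k =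
  ≤-antisym (m+suc-n≤2⇒m≤1 (≤-trans (term+length≤sumFin (suc n) t t≥1 k) sum≤2)) (t≥1 k)
  where
  m+suc-n≤2⇒m≤1 : ∀ {m} → m + suc n ≤ 2 → m ≤ 1
  m+suc-n≤2⇒m≤1 {m} le = ≤-trans (m≤m+n m n) (s≤s⁻¹ (subst (_≤ 2) (+-suc m n) le))

Fin-≤1-irrelevant : ∀ {n} → n ≤ 1 → Irrelevant (Fin n)
Fin-≤1-irrelevant {suc zero}    _        zero zero = refl
Fin-≤1-irrelevant {suc (suc _)} (s≤s ()) _    _

module _ {o ℓ d s : Level} {𝐂 : Category o ℓ} (G : GaloisSetting 𝐂 d s) where
  open Category 𝐂
  open CatDefs 𝐂
  open GaloisSetting G
  open Sub D
  open GaloisDefs G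

  ∘-cancel-inner : ∀ {A B C E} {g : Hom B C} {h : Hom C B} (k : Hom B E) (l : Hom A B) →
                   h ∘ g ≡ id → (k ∘ h) ∘ (g ∘ l) ≡ k ∘ l
  ∘-cancel-inner {g = g} {h} k l h∘g≡id = begin
    (k ∘ h) ∘ (g ∘ l)  ≡⟨ assoc (g ∘ l) h k ⟩
    k ∘ (h ∘ (g ∘ l))  ≡⟨ cong (k ∘_) (sym (assoc l g h)) ⟩
    k ∘ ((h ∘ g) ∘ l)  ≡⟨ cong (λ m → k ∘ (m ∘ l)) h∘g≡id ⟩
    k ∘ (id ∘ l)       ≡⟨ cong (k ∘_) (identityˡ l) ⟩
    k ∘ l              ∎
    where open ≡-Reasoning

  IsIso-∘ : ∀ {A B C} {g : Hom A B} {h : Hom B C} → IsIso g → IsIso h → IsIso (h ∘ g)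
  IsIso-∘ {g = g} {h} (g⁻¹ , g⁻¹∘g , g∘g⁻¹) (h⁻¹ , h⁻¹∘h , h∘h⁻¹) =
    g⁻¹ ∘ h⁻¹ ,
    trans (∘-cancel-inner g⁻¹ g h⁻¹∘h) g⁻¹∘g ,
    trans (∘-cancel-inner h h⁻¹ g∘g⁻¹) h∘h⁻¹

  IsIso-cancelˡ : ∀ {A B C} {g : Hom B C} {t u : Hom A B} → IsIso g → g ∘ t ≡ g ∘ u → t ≡ u
  IsIso-cancelˡ {g = g} {t} {u} (g⁻¹ , g⁻¹∘g , _) g∘t≡g∘u = begin
    t               ≡⟨ sym (identityˡ t) ⟩
    id ∘ t          ≡⟨ cong (_∘ t) (sym g⁻¹∘g) ⟩
    (g⁻¹ ∘ g) ∘ t   ≡⟨ assoc t g g⁻¹ ⟩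
    g⁻¹ ∘ (g ∘ t)   ≡⟨ cong (g⁻¹ ∘_) g∘t≡g∘u ⟩
    g⁻¹ ∘ (g ∘ u)   ≡⟨ sym (assoc u g g⁻¹) ⟩
    (g⁻¹ ∘ g) ∘ u   ≡⟨ cong (_∘ u) g⁻¹∘g ⟩
    id ∘ u          ≡⟨ identityˡ u ⟩
    u               ∎
    where open ≡-Reasoning

  deg-id : ∀ {A} (a : D A) → deg (id {A}) a ≡ 1
  deg-id a = *-cancelˡ-≡ (deg id a) 1 (deg id a) {{>-nonZero (deg-pos id a)}} (begin
    deg id a * deg id a  ≡⟨ sym (deg-∘ id id a a) ⟩
    deg (id ∘ id) a      ≡⟨ cong (λ g → deg g a) (identityˡ id) ⟩
    deg id a             ≡⟨ sym (*-identityʳ (deg id a)) ⟩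
    deg id a * 1         ∎)
    where open ≡-Reasoning

  deg-retraction : ∀ {A V} (a : D A) (v : D V) {r : Hom V A} (h : Hom A V) → r ∘ h ≡ id →
                   deg r a ≡ 1
  deg-retraction a v {r} h r∘h≡id = m*n≡1⇒m≡1 (deg r a) (deg h v) (begin
    deg r a * deg h v  ≡⟨ sym (deg-∘ h r v a) ⟩
    deg (r ∘ h) a      ≡⟨ cong (λ g → deg g a) r∘h≡id ⟩
    deg id a           ≡⟨ deg-id a ⟩
    1                  ∎)
    where open ≡-Reasoning

  deg-cancelˡ : ∀ {W A B} (w : D W) (b : D B) {f : Hom W B} {g h : Hom A W} →
                f ∘ g ≡ f ∘ h → deg g w ≡ deg h w
  deg-cancelˡ w b {f} {g} {h} f∘g≡f∘h =
    *-cancelˡ-≡ (deg g w) (deg h w) (deg f b) {{>-nonZero (deg-pos f b)}} (begin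
      deg f b * deg g w  ≡⟨ sym (deg-∘ g f w b) ⟩
      deg (f ∘ g) b      ≡⟨ cong (λ k → deg k b) f∘g≡f∘h ⟩
      deg (f ∘ h) b      ≡⟨ deg-∘ h f w b ⟩
      deg f b * deg h w  ∎)
    where open ≡-Reasoning

  factor-∘ : ∀ {A B C E} {u : Hom A E} {g : Hom B E} {t : Hom A B} (c : Hom E C) →
             u ≡ g ∘ t → (c ∘ g) ∘ t ≡ c ∘ u
  factor-∘ {g = g} {t} c u≡g∘t = trans (assoc t g c) (cong (c ∘_) (sym u≡g∘t))

  index : ∀ {W V} → D W → Hom W V → Idx V
  index w u = proj₁ (Σ-unique w u)

  through-index : ∀ {W V} (w : D W) (u : Hom W V) → HomOver u (Sarr (index w u))
  through-index w u = proj₁ (proj₂ (Σ-unique w u))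

  index-unique : ∀ {W V} (w : D W) {u : Hom W V} {j : Idx V} → HomOver u (Sarr j) → j ≡ index w u
  index-unique w {u} {j} = proj₂ (proj₂ (Σ-unique w u)) j

  deg≡1⇒Idx-irrelevant : ∀ {V A} (a : D A) (g : Hom V A) → deg g a ≡ 1 → Irrelevant (Idx V)
  deg≡1⇒Idx-irrelevant a g deg≡1 i j with deg-sum g a
  ... | n , (e , _ , e-surj) , deg≡sum with e-surj i | e-surj j
  ... | k , ek≡i | l , el≡j = trans (sym ek≡i) (trans (cong e (Fin-≤1-irrelevant n≤1 k l)) el≡j)
    where
    n≤1 : n ≤ 1
    n≤1 = subst (n ≤_) (trans (sym deg≡sum) deg≡1)
                (sumFin-≥-length n _ (λ k → deg-pos (g ∘ Sarr (e k)) a))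

  module KernelPair {X Y} (x : D X) (y : D Y) (f : Hom X Y) where
    open Pullback (pullback y x x f f) public
    open IsPullback isPullback public

    deg-f≡deg-p : deg f y ≡ deg p x
    deg-f≡deg-p = proj₂ (deg-pb y x x f f p q isPullback)

    pair : ∀ {W} (a b : Hom W X) → f ∘ a ≡ f ∘ b → Hom W U
    pair a b eq = proj₁ (universal a b eq)

    module _ {W} {a b : Hom W X} (eq : f ∘ a ≡ f ∘ b) where
      p∘pair : p ∘ pair a b eq ≡ a
      p∘pair = proj₁ (proj₁ (proj₂ (universal a b eq)))

      q∘pair : q ∘ pair a b eq ≡ b
      q∘pair = proj₂ (proj₁ (proj₂ (universal a b eq)))

      pair-unique : (m : Hom W U) → p ∘ m ≡ a → q ∘ m ≡ b → m ≡ pair a b eq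
      pair-unique = proj₂ (proj₂ (universal a b eq))

    Δ : Hom X U
    Δ = pair id id refl

    i₀ : Idx U
    i₀ = index x Δ

    -- Both sides are left inverses of the factor of Δ through Sarr i₀, which is epic.
    p∘Sarr-i₀≡q∘Sarr-i₀ : p ∘ Sarr i₀ ≡ q ∘ Sarr i₀
    p∘Sarr-i₀≡q∘Sarr-i₀ with through-index x Δ
    ... | h , Δ≡Sarr∘h = epic x (Sdom∈D i₀) h x (p ∘ Sarr i₀) (q ∘ Sarr i₀) (begin
      (p ∘ Sarr i₀) ∘ h  ≡⟨ factor-∘ p Δ≡Sarr∘h ⟩
      p ∘ Δ              ≡⟨ p∘pair refl ⟩
      id                 ≡⟨ sym (q∘pair refl) ⟩
      q ∘ Δ              ≡⟨ sym (factor-∘ q Δ≡Sarr∘h) ⟩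
      (q ∘ Sarr i₀) ∘ h  ∎)
      where open ≡-Reasoning

  deg≡1⇒iso : ∀ {A B} (a : D A) (b : D B) (g : Hom A B) → deg g b ≡ 1 → IsIso g
  deg≡1⇒iso a b g deg≡1 = monic⇒iso a b g monic
    where
    open KernelPair a b g

    Idx-U-irrelevant : Irrelevant (Idx U)
    Idx-U-irrelevant = deg≡1⇒Idx-irrelevant a p (trans (sym deg-f≡deg-p) deg≡1)

    monic : MonicInD g
    monic w u v g∘u≡g∘v
      with subst (λ j → HomOver (pair u v g∘u≡g∘v) (Sarr j)) (Idx-U-irrelevant _ _)
                 (through-index w (pair u v g∘u≡g∘v))
    ... | t , pair≡Sarr∘t = begin
      u                          ≡⟨ sym (p∘pair g∘u≡g∘v) ⟩
      p ∘ pair u v g∘u≡g∘v       ≡⟨ sym (factor-∘ p pair≡Sarr∘t) ⟩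
      (p ∘ Sarr i₀) ∘ t          ≡⟨ cong (_∘ t) p∘Sarr-i₀≡q∘Sarr-i₀ ⟩
      (q ∘ Sarr i₀) ∘ t          ≡⟨ factor-∘ q pair≡Sarr∘t ⟩
      q ∘ pair u v g∘u≡g∘v       ≡⟨ q∘pair g∘u≡g∘v ⟩
      v                          ∎
      where open ≡-Reasoning

  module Automorphisms {X Y} (x : D X) (y : D Y) (f : Hom X Y) where
    open KernelPair x y f

    term : Idx U → ℕ
    term j = deg (p ∘ Sarr j) x

    graph : Aut f → Hom X U
    graph τ = pair id (proj₁ τ) (trans (identityʳ f) (proj₂ (proj₂ τ)))

    graphIndex : Aut f → Idx U
    graphIndex τ = index x (graph τ)

    graph-cong : (τ σ : Aut f) → proj₁ τ ≡ proj₁ σ → graph τ ≡ graph σ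
    graph-cong τ σ τ≡σ = pair-unique _ (graph τ) (p∘pair _) (trans (q∘pair _) τ≡σ)

    p∘Sarr-retracts-graph : ∀ (τ : Aut f) {j} (τ-through-j : HomOver (graph τ) (Sarr j)) →
                            (p ∘ Sarr j) ∘ proj₁ τ-through-j ≡ id
    p∘Sarr-retracts-graph τ (_ , graph≡) = trans (factor-∘ p graph≡) (p∘pair _)

    term-graphIndex : (τ : Aut f) → term (graphIndex τ) ≡ 1
    term-graphIndex τ = deg-retraction x (Sdom∈D (graphIndex τ)) (proj₁ τ-through)
                                       (p∘Sarr-retracts-graph τ τ-through)
      where
      τ-through : HomOver (graph τ) (Sarr (graphIndex τ))
      τ-through = through-index x (graph τ)

    graph-determines : ∀ (τ σ : Aut f) {j} → HomOver (graph τ) (Sarr j) → HomOver (graph σ) (Sarr j) →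
                       proj₁ τ ≡ proj₁ σ
    graph-determines τ σ {j} (t , τ≡) (u , σ≡) = begin
      proj₁ τ           ≡⟨ sym (q∘pair _) ⟩
      q ∘ graph τ       ≡⟨ sym (factor-∘ q τ≡) ⟩
      (q ∘ Sarr j) ∘ t  ≡⟨ cong ((q ∘ Sarr j) ∘_) t≡u ⟩
      (q ∘ Sarr j) ∘ u  ≡⟨ factor-∘ q σ≡ ⟩
      q ∘ graph σ       ≡⟨ q∘pair _ ⟩
      proj₁ σ           ∎
      where
      open ≡-Reasoning
      α∘t≡id : (p ∘ Sarr j) ∘ t ≡ id
      α∘t≡id = p∘Sarr-retracts-graph τ (t , τ≡)
      α-iso : IsIso (p ∘ Sarr j)
      α-iso = deg≡1⇒iso (Sdom∈D j) x (p ∘ Sarr j) (deg-retraction x (Sdom∈D j) t α∘t≡id)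
      t≡u : t ≡ u
      t≡u = IsIso-cancelˡ α-iso (trans α∘t≡id (sym (p∘Sarr-retracts-graph σ (u , σ≡))))

    graphIndex-injective : ∀ (τ σ : Aut f) → graphIndex τ ≡ graphIndex σ → proj₁ τ ≡ proj₁ σ
    graphIndex-injective τ σ τσ-index≡ = graph-determines τ σ (through-index x (graph τ))
      (subst (λ j → HomOver (graph σ) (Sarr j)) (sym τσ-index≡) (through-index x (graph σ)))

    -- For term j ≡ 1 both projections p ∘ Sarr j and q ∘ Sarr j are isomorphisms, and
    -- the automorphism with graph index j is their quotient.
    module _ (j : Idx U) (term≡1 : term j ≡ 1) where
      private
        α β : Hom (Sdom j) X
        α = p ∘ Sarr j
        β = q ∘ Sarr j

        α-iso : IsIso α
        α-iso = deg≡1⇒iso (Sdom∈D j) x α term≡1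

        α⁻¹ : Hom X (Sdom j)
        α⁻¹ = proj₁ α-iso

        α∘α⁻¹≡id : α ∘ α⁻¹ ≡ id
        α∘α⁻¹≡id = proj₂ (proj₂ α-iso)

        f∘β≡f∘α : f ∘ β ≡ f ∘ α
        f∘β≡f∘α = trans (sym (assoc (Sarr j) q f))
                        (trans (cong (_∘ Sarr j) (sym commute)) (assoc (Sarr j) p f))

        β-iso : IsIso β
        β-iso = deg≡1⇒iso (Sdom∈D j) x β (trans (deg-cancelˡ x y f∘β≡f∘α) term≡1)

        f∘β∘α⁻¹≡f : f ∘ (β ∘ α⁻¹) ≡ f
        f∘β∘α⁻¹≡f = begin
          f ∘ (β ∘ α⁻¹)  ≡⟨ sym (assoc α⁻¹ β f) ⟩
          (f ∘ β) ∘ α⁻¹  ≡⟨ cong (_∘ α⁻¹) f∘β≡f∘α ⟩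
          (f ∘ α) ∘ α⁻¹  ≡⟨ assoc α⁻¹ α f ⟩
          f ∘ (α ∘ α⁻¹)  ≡⟨ cong (f ∘_) α∘α⁻¹≡id ⟩
          f ∘ id         ≡⟨ identityʳ f ⟩
          f              ∎
          where open ≡-Reasoning

      automorphism-at : Aut f
      automorphism-at = β ∘ α⁻¹ , IsIso-∘ (α , α∘α⁻¹≡id , proj₁ (proj₂ α-iso)) β-iso , sym f∘β∘α⁻¹≡f

      graphIndex-automorphism-at : graphIndex automorphism-at ≡ j
      graphIndex-automorphism-at = sym (index-unique x (α⁻¹ , sym graph≡Sarr∘α⁻¹))
        where
        graph≡Sarr∘α⁻¹ : Sarr j ∘ α⁻¹ ≡ graph automorphism-at
        graph≡Sarr∘α⁻¹ = pair-unique _ (Sarr j ∘ α⁻¹)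
          (trans (sym (assoc α⁻¹ (Sarr j) p)) α∘α⁻¹≡id) (sym (assoc α⁻¹ (Sarr j) q))

    unramified⇒Galois : (∀ j → term j ≡ 1) → IsGalois x y f
    unramified⇒Galois term≡1 with deg-sum p x
    ... | n , (e , e-inj , e-surj) , deg-p≡sum =
      subst (HasCardBy {A = Aut f} proj₁) (sym deg-f≡n) (enum , enum-inj , enum-surj)
      where
      deg-f≡n : deg f y ≡ n
      deg-f≡n = trans deg-f≡deg-p (trans deg-p≡sum (sumFin-ones n _ (λ k → term≡1 (e k))))

      enum : Fin n → Aut f
      enum k = automorphism-at (e k) (term≡1 (e k))

      graphIndex-enum : ∀ k → graphIndex (enum k) ≡ e k
      graphIndex-enum k = graphIndex-automorphism-at (e k) (term≡1 (e k))

      enum-inj : ∀ k l → proj₁ (enum k) ≡ proj₁ (enum l) → k ≡ l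
      enum-inj k l kl≡ = e-inj k l (begin
        e k                   ≡⟨ sym (graphIndex-enum k) ⟩
        graphIndex (enum k)   ≡⟨ cong (index x) (graph-cong (enum k) (enum l) kl≡) ⟩
        graphIndex (enum l)   ≡⟨ graphIndex-enum l ⟩
        e l                   ∎)
        where open ≡-Reasoning

      enum-surj : ∀ τ → Σ (Fin n) λ k → proj₁ (enum k) ≡ proj₁ τ
      enum-surj τ with e-surj (graphIndex τ)
      ... | k , ek≡ = k , graphIndex-injective (enum k) τ (trans (graphIndex-enum k) ek≡)

    idAut : Aut f
    idAut = id , (id , identityˡ id , identityˡ id) , sym (identityʳ f)

    -- The graph index of the identity always contributes a term 1 to deg f = Σ term,
    -- so a total of at most 2 leaves no room for a term above 1.
    deg≤2⇒unramified : deg f y ≤ 2 → ∀ j → term j ≡ 1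
    deg≤2⇒unramified deg≤2 j with deg-sum p x
    ... | n , (e , _ , e-surj) , deg-p≡sum with e-surj (graphIndex idAut) | e-surj j
    ... | k₀ , ek₀≡ | k , ek≡j =
      subst (λ i → term i ≡ 1) ek≡j
        (sumFin≤2⇒ones n (λ l → term (e l)) (λ l → deg-pos (p ∘ Sarr (e l)) x) sum≤2
                       k₀ (trans (cong term ek₀≡) (term-graphIndex idAut)) k)
      where
      sum≤2 : sumFin n (λ l → term (e l)) ≤ 2
      sum≤2 = subst (_≤ 2) (trans deg-f≡deg-p deg-p≡sum) deg≤2

corollary4p6 : ∀ {o ℓ d s} {𝐂 : Category o ℓ} (G : GaloisSetting 𝐂 d s) →
    GaloisDefs.Cor46 G
corollary4p6 G x y f deg≤2 = unramified⇒Galois (deg≤2⇒unramified deg≤2)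
  where open Automorphisms G x y f
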